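{- Let $G$ be the infinite grid graph with vertex set $\mathbb{Z}^2$, and let $f$ be any flow configuration on $G$ (in the sense given in the context). Suppose there is a vertex $v$ with $|\mathrm{inflow}(v)-\mathrm{outflow}(v)|>4$. Then the flow-firing process started from $f$ does not terminate: every configuration reachable from $f$ by a finite sequence of firings has at least one edge that can fire.
   Context: Each edge of the grid graph $G$ (vertices $\mathbb{Z}^2$, edges between points at Euclidean distance $1$) is oriented from South to North or from West to East. A flow configuration is a function $f$ assigning an integer $f_e$ to each edge $e$; $f_e>0$ means $f_e$ units of flow along the orientation of $e$, $f_e<0$ means $|f_e|$ units of flow against it. For a vertex $v$, $\mathrm{inflow}(v)-\mathrm{outflow}(v)$ is the net flow into $v$, i.e. $\sum_{e \text{ oriented into } v} f_e-\sum_{e \text{ oriented out of } v} f_e$. The faces of $G$ are the unit squares; each edge lies in exactly two faces. Rerouting one unit of flow on an edge $e$ across a face $\sigma\ni e$ means replacing one unit of flow along $e$ (in the direction in which flow currently runs on $e$) by one unit of flow along the path formed by the other three edges of $\sigma$ (with the same start and end vertices), adding these units to the existing values (flows in opposite directions cancel). Flow-firing process: at each step choose an edge $e$ with $|f_e|\ge 2$ and fire it, i.e. reroute one unit of its flow across each of the two faces containing $e$. The process terminates when no edge has $|f_e|\ge 2$. -}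

module Defs where

open import Data.Nat using (ℕ) renaming (_≤_ to _≤ℕ_)
open import Data.Integer using (ℤ; +_; -[1+_]; +[1+_]; _+_; _-_; _*_; -_; ∣_∣; _≟_)
open import Data.Product using (_×_; _,_)
open import Data.Bool using (if_then_else_)
open import Relation.Nullary using (Dec; yes; no)
open import Relation.Nullary.Decidable using (⌊_⌋; _×-dec_)

-- Edges of the grid graph on ℤ².
--   hor x y : the edge (x,y) → (x+1,y)   (oriented West to East)
--   ver x y : the edge (x,y) → (x,y+1)   (oriented South to North)
data Edge : Set where
  hor : ℤ → ℤ → Edge
  ver : ℤ → ℤ → Edge

FlowConfig : Set
FlowConfig = Edge → ℤ

netFlow : FlowConfig → ℤ → ℤ → ℤ
netFlow f x y = (f (hor (x - + 1) y) + f (ver x (y - + 1))) - (f (hor x y) + f (ver x y))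

at : ℤ → ℤ → ℤ → ℤ → ℤ
at p q a b = if ⌊ (p ≟ a) ×-dec (q ≟ b) ⌋ then + 1 else + 0

-- Faces: the unit square with lower-left corner (a,b).
-- bd a b e : coefficient of edge e in the counterclockwise oriented
-- boundary of that face (+1 if the boundary traverses e along its
-- orientation, -1 if against it, 0 if e is not on the face).
bd : ℤ → ℤ → Edge → ℤ
bd a b (hor x y) = at x y a b - at x y a (b + + 1)
bd a b (ver x y) = at x y (a + + 1) b - at x y a b

sgn : ℤ → ℤ
sgn (+ 0) = + 0
sgn +[1+ n ] = + 1
sgn -[1+ n ] = - + 1

-- Reroute one unit of flow on e (in its current direction s) across the
-- face with lower-left corner (a,b): remove s units along e, add s units
-- along the other three edges from start to end of e.  This equals
-- subtracting s·ε·∂σ, where ε = bd a b e is the sign of e in ∂σ.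
reroute : Edge → ℤ → ℤ → FlowConfig → FlowConfig
reroute e a b f e' = f e' - (sgn (f e) * bd a b e) * bd a b e'

fire : Edge → FlowConfig → FlowConfig
fire (hor x y) f = reroute (hor x y) x (y - + 1) (reroute (hor x y) x y f)
fire (ver x y) f = reroute (ver x y) (x - + 1) y (reroute (ver x y) x y f)

CanFire : FlowConfig → Edge → Set
CanFire f e = 2 ≤ℕ ∣ f e ∣

data Reachable (f : FlowConfig) : FlowConfig → Set where
  here : Reachable f f
  step : ∀ {g} e → Reachable f g → CanFire g e → Reachable f (fire e g)

module Submission where

-- The net flow at a vertex is an invariant of the
-- flow-firing process, and a configuration with no firable edge has net
-- flow of absolute value at most 4 at every vertex.  Hence a vertex with
-- |net flow| > 4 prevents every reachable configuration from being stuck.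

open import Defs
open import Data.Nat using (_<_)
open import Data.Integer using (ℤ; ∣_∣)
open import Data.Product using (∃; Σ)

open import Data.Nat using (_≤?_) renaming (_≤_ to _≤ℕ_; _+_ to _+ℕ_)
import Data.Nat.Properties as ℕP
open import Data.Integer using (+_; _+_; _-_; _*_; _≟_)
import Data.Integer.Properties as ℤP
open import Data.Integer.Tactic.RingSolver using (solve-∀)
open import Data.Bool using (if_then_else_)
open import Data.Product using (_,_)
open import Data.Product.Function.NonDependent.Propositional using (_×-⇔_)
open import Function using (id)
open import Function.Bundles using (_⇔_; mk⇔)
open import Relation.Nullary using (yes; no; ¬_; does; contradiction)
open import Relation.Nullary.Decidable using (⌊_⌋; _×-dec_; isYes≗does; does-⇔)
open import Relation.Binary.PropositionalEquality
  using (_≡_; refl; sym; trans; cong; subst; module ≡-Reasoning)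

at-cong : ∀ {p q a b p′ q′ a′ b′} →
  ((p ≡ a) ⇔ (p′ ≡ a′)) → ((q ≡ b) ⇔ (q′ ≡ b′)) → at p q a b ≡ at p′ q′ a′ b′
at-cong {p} {q} {a} {b} {p′} {q′} {a′} {b′} p⇔p′ q⇔q′ =
  cong (λ c → if c then + 1 else + 0) (begin
    ⌊ cond ⌋    ≡⟨ isYes≗does cond ⟩
    does cond   ≡⟨ does-⇔ (p⇔p′ ×-⇔ q⇔q′) cond cond′ ⟩
    does cond′  ≡⟨ sym (isYes≗does cond′) ⟩
    ⌊ cond′ ⌋   ∎)
  where
  open ≡-Reasoning
  cond  = (p ≟ a) ×-dec (q ≟ b)
  cond′ = (p′ ≟ a′) ×-dec (q′ ≟ b′)

pred≡⇔≡suc : (p a : ℤ) → (p - + 1 ≡ a) ⇔ (p ≡ a + + 1)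
pred≡⇔≡suc p a = mk⇔
  (λ eq → trans (sym (pred-suc p)) (cong (_+ + 1) eq))
  (λ eq → trans (cong (_- + 1) eq) (suc-pred a))
  where
  pred-suc : ∀ p → (p - + 1) + + 1 ≡ p
  pred-suc = solve-∀
  suc-pred : ∀ a → (a + + 1) - + 1 ≡ a
  suc-pred = solve-∀

at-shiftˡ : ∀ p q a b → at (p - + 1) q a b ≡ at p q (a + + 1) b
at-shiftˡ p q a b = at-cong (pred≡⇔≡suc p a) (mk⇔ id id)

at-shiftʳ : ∀ p q a b → at p (q - + 1) a b ≡ at p q a (b + + 1)
at-shiftʳ p q a b = at-cong (mk⇔ id id) (pred≡⇔≡suc q b)

netFlow-linear : ∀ (f h : FlowConfig) k x y →
  netFlow (λ e → f e - k * h e) x y ≡ netFlow f x y - k * netFlow h x y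
netFlow-linear f h k x y =
  identity (f (hor (x - + 1) y)) (f (ver x (y - + 1))) (f (hor x y)) (f (ver x y))
           (h (hor (x - + 1) y)) (h (ver x (y - + 1))) (h (hor x y)) (h (ver x y)) k
  where
  identity : ∀ P Q R S p q r s k →
    ((P - k * p) + (Q - k * q)) - ((R - k * r) + (S - k * s))
      ≡ ((P + Q) - (R + S)) - k * ((p + q) - (r + s))
  identity = solve-∀

-- The boundary of the face with lower-left corner (a,b) is a circulation:
-- every vertex of the square has one boundary edge entering and one leaving.
netFlow-bd : ∀ a b x y → netFlow (bd a b) x y ≡ + 0
netFlow-bd a b x y
  rewrite at-shiftˡ x y a b | at-shiftˡ x y a (b + + 1)
        | at-shiftʳ x y (a + + 1) b | at-shiftʳ x y a b
  = cancel (at x y (a + + 1) b) (at x y (a + + 1) (b + + 1)) (at x y a (b + + 1)) (at x y a b)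
  where
  cancel : ∀ A C D E → ((A - C) + (C - D)) - ((E - D) + (A - E)) ≡ + 0
  cancel = solve-∀

netFlow-reroute : ∀ e a b f x y → netFlow (reroute e a b f) x y ≡ netFlow f x y
netFlow-reroute e a b f x y = begin
  netFlow (reroute e a b f) x y        ≡⟨ netFlow-linear f (bd a b) k x y ⟩
  netFlow f x y - k * netFlow (bd a b) x y
                                       ≡⟨ cong (λ n → netFlow f x y - k * n) (netFlow-bd a b x y) ⟩
  netFlow f x y - k * + 0              ≡⟨ minus-zero (netFlow f x y) k ⟩
  netFlow f x y                        ∎
  where
  open ≡-Reasoning
  k = sgn (f e) * bd a b e
  minus-zero : ∀ n k → n - k * + 0 ≡ n
  minus-zero = solve-∀

netFlow-fire : ∀ e f x y → netFlow (fire e f) x y ≡ netFlow f x y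
netFlow-fire (hor a b) f x y =
  trans (netFlow-reroute (hor a b) a (b - + 1) (reroute (hor a b) a b f) x y)
        (netFlow-reroute (hor a b) a b f x y)
netFlow-fire (ver a b) f x y =
  trans (netFlow-reroute (ver a b) (a - + 1) b (reroute (ver a b) a b f) x y)
        (netFlow-reroute (ver a b) a b f x y)

netFlow-reachable : ∀ {f g} → Reachable f g → ∀ x y → netFlow g x y ≡ netFlow f x y
netFlow-reachable here           x y = refl
netFlow-reachable (step e r _)   x y = trans (netFlow-fire e _ x y) (netFlow-reachable r x y)

≤1-if-not-firable : ∀ g e → ¬ CanFire g e → ∣ g e ∣ ≤ℕ 1
≤1-if-not-firable g e cannot = ℕP.≮⇒≥ cannot

∣netFlow∣-bound : ∀ g x y →
  ∣ netFlow g x y ∣ ≤ℕ (∣ g (hor (x - + 1) y) ∣ +ℕ ∣ g (ver x (y - + 1)) ∣)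
                      +ℕ (∣ g (hor x y) ∣ +ℕ ∣ g (ver x y) ∣)
∣netFlow∣-bound g x y = ℕP.≤-trans (ℤP.∣i-j∣≤∣i∣+∣j∣ (A + B) (C + D))
  (ℕP.+-mono-≤ (ℤP.∣i+j∣≤∣i∣+∣j∣ A B) (ℤP.∣i+j∣≤∣i∣+∣j∣ C D))
  where
  A = g (hor (x - + 1) y) ; B = g (ver x (y - + 1)) ; C = g (hor x y) ; D = g (ver x y)

firable-at-large-netFlow : ∀ g x y → 4 < ∣ netFlow g x y ∣ → ∃ λ e → CanFire g e
firable-at-large-netFlow g x y large
  with 2 ≤? ∣ g (hor (x - + 1) y) ∣ | 2 ≤? ∣ g (ver x (y - + 1)) ∣
     | 2 ≤? ∣ g (hor x y) ∣         | 2 ≤? ∣ g (ver x y) ∣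
... | yes can | _       | _       | _       = _ , can
... | no _    | yes can | _       | _       = _ , can
... | no _    | no _    | yes can | _       = _ , can
... | no _    | no _    | no _    | yes can = _ , can
... | no c₁   | no c₂   | no c₃   | no c₄   = contradiction at-most-4 (ℕP.<⇒≱ large)
  where
  at-most-4 : ∣ netFlow g x y ∣ ≤ℕ 4
  at-most-4 = ℕP.≤-trans (∣netFlow∣-bound g x y)
    (ℕP.+-mono-≤ (ℕP.+-mono-≤ (≤1-if-not-firable g _ c₁) (≤1-if-not-firable g _ c₂))
                 (ℕP.+-mono-≤ (≤1-if-not-firable g _ c₃) (≤1-if-not-firable g _ c₄)))

proposition4p1 : (f : FlowConfig) (x y : ℤ) → 4 < ∣ netFlow f x y ∣ →
    (g : FlowConfig) → Reachable f g → ∃ λ e → CanFire g e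
proposition4p1 f x y large g reach =
  firable-at-large-netFlow g x y
    (subst (λ n → 4 < ∣ n ∣) (sym (netFlow-reachable reach x y)) large)
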